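{- Let $p$ be an odd prime and write $p-1 = 2^{\nu_2(p-1)} r$ with $r$ odd. Then $2p\in S_k$ if and only if \[ p \equiv 3 \pmod{4} \quad \text{and} \quad r \mid \bigl(2^{k+1}+1\bigr). \]
   Context: For integers $k\ge 0$ and $n\ge 1$, $\sigma_k(n)=\sum_{d\mid n} d^k$ and $\phi(n)$ is Euler's totient function. For each $k\geq 0$, $S_k$ denotes the set of composite positive integers $n$ satisfying $n\cdot\sigma_k(n)\equiv 2 \pmod{\phi(n)}$. $\nu_2(m)$ denotes the largest $a$ with $2^a\mid m$. -}

module Defs where

open import Data.Nat using (ℕ; zero; suc; _+_; _*_; _^_; ∣_-_∣)
open import Data.Nat.Divisibility using (_∣_; _∣?_)
open import Data.Nat.Coprimality using (Coprime; coprime?)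
open import Data.Nat.Primality using (Composite)
open import Data.List using (List; map; length; filter; applyUpTo)
open import Data.Nat.ListAction using (sum)
open import Relation.Nullary using (¬_)
open import Data.Product using (_×_)

range1 : ℕ → List ℕ
range1 n = applyUpTo suc n

σ : ℕ → ℕ → ℕ
σ k n = sum (map (λ d → d ^ k) (filter (λ d → d ∣? n) (range1 n)))

φ : ℕ → ℕ
φ n = length (filter (λ m → coprime? m n) (range1 n))

_≡_[mod_] : ℕ → ℕ → ℕ → Set
a ≡ b [mod m ] = m ∣ ∣ a - b ∣

InS : ℕ → ℕ → Set
InS k n = Composite n × ((n * σ k n) ≡ 2 [mod φ n ])

Odd : ℕ → Set
Odd n = ¬ (2 ∣ n)

-- For an odd prime p the divisors of 2p are 1, 2, p, 2p, and the integers in [1, 2p]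
-- coprime to 2p are the odd ones other than p; hence σ_k(2p) = 1 + 2^k + p^k + (2p)^k
-- and φ(2p) = p - 1. Since p ≡ 1 (mod p - 1), 2p σ_k(2p) - 2 ≡ 2(2^(k+1) + 1), so
-- 2p ∈ S_k iff h ∣ 2^(k+1) + 1, where p - 1 = 2h. As 2^(k+1) + 1 is odd, such an h is
-- odd, i.e. p ≡ 3 (mod 4), and then h = r; conversely an odd h equals r.
{-# OPTIONS --safe #-}
module Submission where

open import Defs
open import Data.Nat
open import Data.Nat.Properties
open import Data.Nat.Divisibility
open import Data.Nat.Primality
open import Data.Nat.Coprimality using (Coprime; coprime?)
open import Data.Nat.ListAction using (sum)
open import Data.Nat.Tactic.RingSolver using (solve-∀)
open import Data.List using (List; []; _∷_; [_]; _++_; map; length; filter)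
open import Data.List.Properties
  using (applyUpTo-∷ʳ; filter-++; filter-accept; filter-reject; length-++; ++-identityʳ)
open import Data.Product using (∃-syntax; _×_; _,_)
open import Data.Product.Function.NonDependent.Propositional using (_×-⇔_)
open import Data.Sum using (_⊎_; inj₁; inj₂)
open import Function using (_∘_)
open import Function.Bundles using (_⇔_; mk⇔)
open import Function.Construct.Identity using (⇔-id)
open import Function.Construct.Symmetry using (⇔-sym)
open import Function.Related.Propositional using (module EquationalReasoning)
open import Level using (Level)
open import Relation.Nullary using (¬_; contradiction)
open import Relation.Unary using (Pred; Decidable)
open import Relation.Binary.PropositionalEquality hiding ([_])

odd⇒≡1+2* : ∀ {n} → Odd n → ∃[ h ] n ≡ suc (2 * h)
odd⇒≡1+2* {zero}        odd = contradiction (2 ∣0) odd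
odd⇒≡1+2* {suc zero}    _   = 0 , refl
odd⇒≡1+2* {suc (suc n)} odd with odd⇒≡1+2* (odd ∘ ∣m∣n⇒∣m+n ∣-refl)
... | h , refl = suc h , cong suc (sym (*-suc 2 h))

even⇒odd-suc : ∀ {n} → 2 ∣ n → Odd (suc n)
even⇒odd-suc {n} 2∣n 2∣1+n =
  contradiction (∣⇒≤ (∣m+n∣m⇒∣n (subst (2 ∣_) (+-comm 1 n) 2∣1+n) 2∣n)) λ { (s≤s ()) }

odd-suc⇒even : ∀ {n} → Odd (suc n) → 2 ∣ n
odd-suc⇒even odd with odd⇒≡1+2* odd
... | h , refl = m∣m*n h

odd[2^[k+1]+1] : ∀ k → Odd (2 ^ (k + 1) + 1)
odd[2^[k+1]+1] k = subst Odd (trans (+-comm 1 (2 ^ suc k)) (cong (λ n → 2 ^ n + 1) (+-comm 1 k)))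
                             (even⇒odd-suc (m∣m*n (2 ^ k)))

module _ {ℓ : Level} {P : Pred ℕ ℓ} (P? : Decidable P) where

  count : ℕ → ℕ
  count n = length (filter P? (range1 n))

  filter-range1-suc : ∀ n → filter P? (range1 (suc n)) ≡ filter P? (range1 n) ++ filter P? [ suc n ]
  filter-range1-suc n = trans (cong (filter P?) (sym (applyUpTo-∷ʳ suc n))) (filter-++ P? (range1 n) [ suc n ])

  filter-range1-accept : ∀ {n} → P (suc n) → filter P? (range1 (suc n)) ≡ filter P? (range1 n) ++ [ suc n ]
  filter-range1-accept {n} Pn =
    trans (filter-range1-suc n) (cong (filter P? (range1 n) ++_) (filter-accept P? Pn))

  filter-range1-reject : ∀ {n} → ¬ P (suc n) → filter P? (range1 (suc n)) ≡ filter P? (range1 n)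
  filter-range1-reject {n} ¬Pn = begin
    filter P? (range1 (suc n))                   ≡⟨ filter-range1-suc n ⟩
    filter P? (range1 n) ++ filter P? [ suc n ]  ≡⟨ cong (filter P? (range1 n) ++_) (filter-reject P? ¬Pn) ⟩
    filter P? (range1 n) ++ []                   ≡⟨ ++-identityʳ _ ⟩
    filter P? (range1 n)                         ∎
    where open ≡-Reasoning

  filter-range1-gap : ∀ {m n} → m ≤ n → (∀ {j} → m < j → j ≤ n → ¬ P j) →
                      filter P? (range1 n) ≡ filter P? (range1 m)
  filter-range1-gap m≤n = go (≤⇒≤′ m≤n)
    where
    go : ∀ {m n} → m ≤′ n → (∀ {j} → m < j → j ≤ n → ¬ P j) →
         filter P? (range1 n) ≡ filter P? (range1 m)
    go ≤′-refl        _   = refl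
    go (≤′-step m≤′n) gap =
      trans (filter-range1-reject (gap (s≤s (≤′⇒≤ m≤′n)) ≤-refl))
            (go m≤′n (λ m<j j≤n → gap m<j (m≤n⇒m≤1+n j≤n)))

  count-accept : ∀ {n} → P (suc n) → count (suc n) ≡ suc (count n)
  count-accept {n} Pn = begin
    length (filter P? (range1 (suc n)))         ≡⟨ cong length (filter-range1-accept Pn) ⟩
    length (filter P? (range1 n) ++ [ suc n ])  ≡⟨ length-++ (filter P? (range1 n)) ⟩
    count n + 1                                 ≡⟨ +-comm (count n) 1 ⟩
    suc (count n)                               ∎
    where open ≡-Reasoning

  count-reject : ∀ {n} → ¬ P (suc n) → count (suc n) ≡ count n
  count-reject ¬Pn = cong length (filter-range1-reject ¬Pn)

  count-odd-block : ∀ c m →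
                    (∀ {i} → i < m → P (suc (2 * (c + i)))) → (∀ {i} → i < m → ¬ P (2 * suc (c + i))) →
                    count (2 * (c + m)) ≡ count (2 * c) + m
  count-odd-block c zero    _   _    = begin
    count (2 * (c + 0))      ≡⟨ cong (λ x → count (2 * x)) (+-identityʳ c) ⟩
    count (2 * c)            ≡⟨ +-identityʳ _ ⟨
    count (2 * c) + 0        ∎
    where open ≡-Reasoning
  count-odd-block c (suc m) odd even = begin
    count (2 * (c + suc m))  ≡⟨ cong (λ x → count (2 * x)) (+-suc c m) ⟩
    count (2 * suc x)        ≡⟨ count-reject (even (n<1+n m)) ⟩
    count (x + suc (x + 0))  ≡⟨ cong count (+-suc x (x + 0)) ⟩
    count (suc (2 * x))      ≡⟨ count-accept (odd (n<1+n m)) ⟩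
    suc (count (2 * x))      ≡⟨ cong suc (count-odd-block c m (odd ∘ m<n⇒m<1+n) (even ∘ m<n⇒m<1+n)) ⟩
    suc (count (2 * c) + m)  ≡⟨ +-suc _ m ⟨
    count (2 * c) + suc m    ∎
    where
    open ≡-Reasoning
    x : ℕ
    x = c + m

∣m*p⇒ : ∀ {m p d} → Prime p → d ∣ m * p → d ∣ m ⊎ ∃[ e ] (e ∣ m × d ≡ e * p)
∣m*p⇒ {m} {p} {d} pp (divides t m*p≡t*d) with euclidsLemma t d pp (divides m (sym m*p≡t*d))
... | inj₁ (divides-refl s) = inj₁ (divides s (*-cancelʳ-≡ m (s * d) p (begin
  m * p        ≡⟨ m*p≡t*d ⟩
  s * p * d    ≡⟨ *-assoc s p d ⟩
  s * (p * d)  ≡⟨ cong (s *_) (*-comm p d) ⟩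
  s * (d * p)  ≡⟨ *-assoc s d p ⟨
  s * d * p    ∎)))
  where
  open ≡-Reasoning
  instance _ = prime⇒nonZero pp
... | inj₂ (divides-refl e) =
  inj₂ (e , divides t (*-cancelʳ-≡ m (t * e) p (trans m*p≡t*d (sym (*-assoc t e p)))) , refl)
  where instance _ = prime⇒nonZero pp

∣2*p⇒ : ∀ {p d} → Prime p → d ∣ 2 * p → d ≡ 1 ⊎ d ≡ 2 ⊎ d ≡ p ⊎ d ≡ 2 * p
∣2*p⇒ pp d∣2p with ∣m*p⇒ pp d∣2p
... | inj₁ d∣2 with prime⇒irreducible prime[2] d∣2
...   | inj₁ d≡1 = inj₁ d≡1
...   | inj₂ d≡2 = inj₂ (inj₁ d≡2)
∣2*p⇒ pp d∣2p | inj₂ (e , e∣2 , refl) with prime⇒irreducible prime[2] e∣2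
...   | inj₁ refl = inj₂ (inj₂ (inj₁ (*-identityˡ _)))
...   | inj₂ refl = inj₂ (inj₂ (inj₂ refl))

∤2*p : ∀ {p d} → Prime p → 2 < d → d < 2 * p → d ≢ p → d ∤ 2 * p
∤2*p pp 2<d d<2p d≢p d∣2p with ∣2*p⇒ pp d∣2p
... | inj₁ refl               = contradiction 2<d λ { (s≤s ()) }
... | inj₂ (inj₁ refl)        = <-irrefl refl 2<d
... | inj₂ (inj₂ (inj₁ d≡p))  = d≢p d≡p
... | inj₂ (inj₂ (inj₂ refl)) = <-irrefl refl d<2p

odd-prime⇒2<p : ∀ {p} → Prime p → Odd p → 2 < p
odd-prime⇒2<p {0}                 pp _     = contradiction pp ¬prime[0]
odd-prime⇒2<p {1}                 pp _     = contradiction pp ¬prime[1]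
odd-prime⇒2<p {2}                 _  2-odd = contradiction ∣-refl 2-odd
odd-prime⇒2<p {suc (suc (suc _))} _  _     = s≤s (s≤s (s≤s z≤n))

divisors[2*p] : ∀ {p} → Prime p → 2 < p → filter (_∣? 2 * p) (range1 (2 * p)) ≡ 1 ∷ 2 ∷ p ∷ 2 * p ∷ []
divisors[2*p] {p@(suc p′)} pp 2<p = begin
  D (2 * p)
    ≡⟨ filter-range1-accept ∣2p? ∣-refl ⟩
  D (2 * p ∸ 1) ++ [ 2 * p ]
    ≡⟨ cong (_++ [ 2 * p ]) (filter-range1-gap ∣2p? (≤-pred p<2p) above-p) ⟩
  D p ++ [ 2 * p ]
    ≡⟨ cong (_++ [ 2 * p ]) (filter-range1-accept ∣2p? (n∣m*n 2)) ⟩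
  (D p′ ++ [ p ]) ++ [ 2 * p ]
    ≡⟨ cong (λ ds → (ds ++ [ p ]) ++ [ 2 * p ]) (filter-range1-gap ∣2p? (≤-pred 2<p) below-p) ⟩
  (D 2 ++ [ p ]) ++ [ 2 * p ]
    ≡⟨ cong (λ ds → (ds ++ [ p ]) ++ [ 2 * p ]) D2 ⟩
  1 ∷ 2 ∷ p ∷ 2 * p ∷ []
    ∎
  where
  open ≡-Reasoning
  ∣2p? : Decidable (_∣ 2 * p)
  ∣2p? = _∣? 2 * p
  D : ℕ → List ℕ
  D n = filter ∣2p? (range1 n)
  p<2p : p < 2 * p
  p<2p = m<m+n p z<s
  above-p : ∀ {j} → p < j → j ≤ 2 * p ∸ 1 → j ∤ 2 * p
  above-p p<j j≤ = ∤2*p pp (<-trans 2<p p<j) (s≤s j≤) (>⇒≢ p<j)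
  below-p : ∀ {j} → 2 < j → j ≤ p′ → j ∤ 2 * p
  below-p 2<j j≤ = ∤2*p pp 2<j (<-trans (s≤s j≤) p<2p) (<⇒≢ (s≤s j≤))
  D2 : D 2 ≡ 1 ∷ 2 ∷ []
  D2 = trans (filter-range1-accept ∣2p? (m∣m*n p)) (cong (_++ [ 2 ]) (filter-range1-accept ∣2p? (1∣ _)))

σ[2*p] : ∀ k {p} → Prime p → 2 < p → σ k (2 * p) ≡ 1 + 2 ^ k + p ^ k + (2 * p) ^ k
σ[2*p] k {p} pp 2<p = begin
  σ k (2 * p)                                    ≡⟨ cong (sum ∘ map (_^ k)) (divisors[2*p] pp 2<p) ⟩
  1 ^ k + (2 ^ k + (p ^ k + ((2 * p) ^ k + 0)))  ≡⟨ cong (_+ (2 ^ k + (p ^ k + ((2 * p) ^ k + 0)))) (^-zeroˡ k) ⟩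
  1 + (2 ^ k + (p ^ k + ((2 * p) ^ k + 0)))      ≡⟨ reassoc (2 ^ k) (p ^ k) ((2 * p) ^ k) ⟩
  1 + 2 ^ k + p ^ k + (2 * p) ^ k                ∎
  where
  open ≡-Reasoning
  reassoc : ∀ a b c → 1 + (a + (b + (c + 0))) ≡ 1 + a + b + c
  reassoc = solve-∀

¬coprime[2*m,2*n] : ∀ m n → ¬ Coprime (2 * m) (2 * n)
¬coprime[2*m,2*n] m n coprime = contradiction (coprime (m∣m*n {2} m , m∣m*n {2} n)) λ ()

¬coprime[p,2*p] : ∀ {p} → Prime p → ¬ Coprime p (2 * p)
¬coprime[p,2*p] pp coprime = ¬prime[1] (subst Prime (coprime (∣-refl , n∣m*n 2)) pp)

odd-multiple<2*p⇒≡p : ∀ {p j} → p ∣ j → Odd j → j < 2 * p → j ≡ p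
odd-multiple<2*p⇒≡p     (divides-refl 0)             j-odd _    = contradiction (2 ∣0) j-odd
odd-multiple<2*p⇒≡p     (divides-refl 1)             _     _    = +-identityʳ _
odd-multiple<2*p⇒≡p {p} (divides-refl (suc (suc s))) _     j<2p =
  contradiction (+-monoʳ-≤ p (+-monoʳ-≤ p z≤n)) (<⇒≱ j<2p)

odd⇒coprime[-,2*p] : ∀ {p j} → Prime p → Odd j → j < 2 * p → j ≢ p → Coprime j (2 * p)
odd⇒coprime[-,2*p] {p} pp j-odd j<2p j≢p (i∣j , i∣2p) with ∣2*p⇒ pp i∣2p
... | inj₁ i≡1                = i≡1
... | inj₂ (inj₁ refl)        = contradiction i∣j j-odd
... | inj₂ (inj₂ (inj₁ refl)) = contradiction (odd-multiple<2*p⇒≡p i∣j j-odd j<2p) j≢p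
... | inj₂ (inj₂ (inj₂ refl)) = contradiction (∣-trans (m∣m*n {2} p) i∣j) j-odd

φ[2*p] : ∀ {p} → Prime p → Odd p → φ (2 * p) ≡ p ∸ 1
φ[2*p] pp p-odd with odd⇒≡1+2* p-odd
... | h , refl = begin
  count C? (2 * p)
    ≡⟨ cong (λ x → count C? (2 * suc (h + x))) (+-identityʳ h) ⟩
  count C? (2 * (suc h + h))
    ≡⟨ count-odd-block C? (suc h) h upper-odd (λ {i} _ → ¬coprime[2*m,2*n] (suc (suc h + i)) p) ⟩
  count C? (2 * suc h) + h
    ≡⟨ cong (_+ h) (count-reject C? (¬coprime[2*m,2*n] (suc h) p)) ⟩
  count C? (h + suc (h + 0)) + h
    ≡⟨ cong (λ x → count C? x + h) (+-suc h (h + 0)) ⟩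
  count C? p + h
    ≡⟨ cong (_+ h) (count-reject C? (¬coprime[p,2*p] pp)) ⟩
  count C? (2 * h) + h
    ≡⟨ cong (_+ h) (count-odd-block C? 0 h lower-odd (λ {i} _ → ¬coprime[2*m,2*n] (suc i) p)) ⟩
  h + h
    ≡⟨ cong (h +_) (+-identityʳ h) ⟨
  2 * h
    ∎
  where
  open ≡-Reasoning
  p : ℕ
  p = suc (2 * h)
  C? : Decidable (λ m → Coprime m (2 * p))
  C? m = coprime? m (2 * p)
  odd<2* : ∀ {x y} → x < y → suc (2 * x) < 2 * y
  odd<2* {x} x<y = ≤-trans (≤-reflexive (sym (*-suc 2 x))) (*-monoʳ-≤ 2 x<y)
  lower-odd : ∀ {i} → i < h → Coprime (suc (2 * i)) (2 * p)
  lower-odd {i} i<h = odd⇒coprime[-,2*p] pp (even⇒odd-suc (m∣m*n i))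
    (odd<2* (<-trans i<h (s≤s (m≤m+n h (h + 0)))))
    (<⇒≢ (s≤s (*-monoʳ-< 2 i<h)))
  upper-odd : ∀ {i} → i < h → Coprime (suc (2 * (suc h + i))) (2 * p)
  upper-odd {i} i<h = odd⇒coprime[-,2*p] pp (even⇒odd-suc (m∣m*n (suc h + i)))
    (odd<2* (s≤s (+-monoʳ-< h (≤-trans i<h (m≤m+n h 0)))))
    (>⇒≢ (s≤s (*-monoʳ-< 2 (s≤s (m≤m+n h i)))))

composite[2*p] : ∀ {p} → 2 < p → Composite (2 * p)
composite[2*p] {p@(suc _)} 2<p = composite-≢ 2 (<⇒≢ (<-≤-trans 2<p (m≤m+n p (p + 0)))) (m∣m*n p)

InS[2*p]⇔ : ∀ k {p} → Prime p → Odd p →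
            InS k (2 * p) ⇔ ((2 * p * (1 + 2 ^ k + p ^ k + (2 * p) ^ k)) ≡ 2 [mod p ∸ 1 ])
InS[2*p]⇔ k {p} pp p-odd = mk⇔
  (λ (_ , congruent) → subst₂ Congruent φ≡ σ≡ congruent)
  (λ congruent → composite[2*p] 2<p , subst₂ Congruent (sym φ≡) (sym σ≡) congruent)
  where
  Congruent : ℕ → ℕ → Set
  Congruent m s = (2 * p * s) ≡ 2 [mod m ]
  2<p : 2 < p
  2<p = odd-prime⇒2<p pp p-odd
  φ≡ : φ (2 * p) ≡ p ∸ 1
  φ≡ = φ[2*p] pp p-odd
  σ≡ : σ k (2 * p) ≡ 1 + 2 ^ k + p ^ k + (2 * p) ^ k
  σ≡ = σ[2*p] k pp 2<p

binomial-mod : ∀ k x y q → ∃[ c ] (x + q * y) ^ k ≡ x ^ k + q * c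
binomial-mod zero    x y q = 0 , cong suc (sym (*-zeroʳ q))
binomial-mod (suc k) x y q =
  let c , eq = binomial-mod k x y q in
  y * x ^ k + x * c + q * y * c , (begin
    (x + q * y) * (x + q * y) ^ k                    ≡⟨ cong ((x + q * y) *_) eq ⟩
    (x + q * y) * (x ^ k + q * c)                    ≡⟨ expand x y q (x ^ k) c ⟩
    x * x ^ k + q * (y * x ^ k + x * c + q * y * c)  ∎)
  where
  open ≡-Reasoning
  expand : ∀ x y q a c → (x + q * y) * (a + q * c) ≡ x * a + q * (y * a + x * c + q * y * c)
  expand = solve-∀

2pσ-mod-q : ∀ k q → ∃[ c ] 2 * suc q * (1 + 2 ^ k + suc q ^ k + (2 * suc q) ^ k)
                          ≡ 2 + (2 * (2 ^ (k + 1) + 1) + q * c)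
2pσ-mod-q k q =
  let c₁ , p^k≡ = binomial-mod k 1 1 q
      c₂ , [2p]^k≡ = binomial-mod k 2 2 q
      c = 2 * (c₁ + c₂) + 4 + 4 * 2 ^ k + 2 * q * (c₁ + c₂)
  in c , (begin
  2 * suc q * (1 + 2 ^ k + suc q ^ k + (2 * suc q) ^ k)
    ≡⟨ cong₂ (λ a b → 2 * suc q * (1 + 2 ^ k + a ^ k + b ^ k)) (1+q≡ q) (2+2q≡ q) ⟩
  2 * suc q * (1 + 2 ^ k + (1 + q * 1) ^ k + (2 + q * 2) ^ k)
    ≡⟨ cong₂ (λ a b → 2 * suc q * (1 + 2 ^ k + a + b)) p^k≡ [2p]^k≡ ⟩
  2 * suc q * (1 + 2 ^ k + (1 ^ k + q * c₁) + (2 ^ k + q * c₂))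
    ≡⟨ cong (λ a → 2 * suc q * (1 + 2 ^ k + (a + q * c₁) + (2 ^ k + q * c₂))) (^-zeroˡ k) ⟩
  2 * suc q * (1 + 2 ^ k + (1 + q * c₁) + (2 ^ k + q * c₂))
    ≡⟨ expand q (2 ^ k) c₁ c₂ ⟩
  2 + (2 * (2 * 2 ^ k + 1) + q * c)
    ≡⟨ cong (λ s → 2 + (2 * (2 ^ s + 1) + q * c)) (+-comm k 1) ⟨
  2 + (2 * (2 ^ (k + 1) + 1) + q * c)
    ∎)
  where
  open ≡-Reasoning
  1+q≡ : ∀ q → suc q ≡ 1 + q * 1
  1+q≡ = solve-∀
  2+2q≡ : ∀ q → 2 * suc q ≡ 2 + q * 2
  2+2q≡ = solve-∀
  expand : ∀ q t c₁ c₂ → 2 * suc q * (1 + t + (1 + q * c₁) + (t + q * c₂)) ≡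
                         2 + (2 * (2 * t + 1) + q * (2 * (c₁ + c₂) + 4 + 4 * t + 2 * q * (c₁ + c₂)))
  expand = solve-∀

∣m+d*n⇔∣m : ∀ {d} m n → d ∣ m + d * n ⇔ d ∣ m
∣m+d*n⇔∣m {d} m n = mk⇔
  (λ d∣m+dn → ∣m+n∣m⇒∣n (subst (d ∣_) (+-comm m (d * n)) d∣m+dn) (m∣m*n n))
  (λ d∣m → ∣m∣n⇒∣m+n d∣m (m∣m*n n))

2pσ≡2[mod-p∸1]⇔ : ∀ k p .{{_ : NonZero p}} →
  ((2 * p * (1 + 2 ^ k + p ^ k + (2 * p) ^ k)) ≡ 2 [mod p ∸ 1 ]) ⇔ (p ∸ 1) ∣ 2 * (2 ^ (k + 1) + 1)
2pσ≡2[mod-p∸1]⇔ k (suc q) =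
  let c , eq = 2pσ-mod-q k q in begin
  ((2 * suc q * (1 + 2 ^ k + suc q ^ k + (2 * suc q) ^ k)) ≡ 2 [mod q ])
    ≡⟨ cong (λ n → q ∣ ∣ n - 2 ∣) eq ⟩
  q ∣ ∣ 2 + (X + q * c) - 2 ∣
    ≡⟨ cong (q ∣_) (trans (∣-∣-comm (2 + (X + q * c)) 2) (∣m-m+n∣≡n 2 (X + q * c))) ⟩
  q ∣ X + q * c
    ∼⟨ ∣m+d*n⇔∣m X c ⟩
  q ∣ X
    ∎
  where
  open EquationalReasoning
  X : ℕ
  X = 2 * (2 ^ (k + 1) + 1)

≡3[mod4]⇔odd : ∀ h → (suc (2 * h) ≡ 3 [mod 4 ]) ⇔ Odd h
≡3[mod4]⇔odd zero    = mk⇔ (λ 4∣2 → contradiction (∣⇒≤ 4∣2) λ { (s≤s (s≤s ())) })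
                           (λ 0-odd → contradiction (2 ∣0) 0-odd)
≡3[mod4]⇔odd (suc g) = begin
  4 ∣ ∣ suc (2 * suc g) - 3 ∣  ≡⟨ cong (λ n → 4 ∣ ∣ suc n - 3 ∣) (*-suc 2 g) ⟩
  4 ∣ ∣ 2 * g - 0 ∣            ≡⟨ cong (4 ∣_) (∣-∣-identityʳ (2 * g)) ⟩
  2 * 2 ∣ 2 * g                ∼⟨ mk⇔ (*-cancelˡ-∣ 2) (*-monoʳ-∣ 2) ⟩
  2 ∣ g                        ∼⟨ mk⇔ even⇒odd-suc odd-suc⇒even ⟩
  Odd (suc g)                  ∎
  where open EquationalReasoning

half-2-adic : ∀ {h a r} → 2 * h ≡ 2 ^ a * r → Odd r → ∃[ b ] h ≡ 2 ^ b * r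
half-2-adic {h} {zero}  {r} 2h≡r     r-odd =
  contradiction (subst (2 ∣_) (trans 2h≡r (*-identityˡ r)) (m∣m*n h)) r-odd
half-2-adic {h} {suc b} {r} 2h≡2^a*r _     =
  b , *-cancelˡ-≡ h (2 ^ b * r) 2 (trans 2h≡2^a*r (*-assoc 2 (2 ^ b) r))

2^b*r∣odd⇔ : ∀ b {r o} → Odd o → 2 ^ b * r ∣ o ⇔ (Odd (2 ^ b * r) × r ∣ o)
2^b*r∣odd⇔ b {r} {o} o-odd = mk⇔
  (λ d∣o → (λ 2∣d → o-odd (∣-trans 2∣d d∣o)) , ∣-trans (n∣m*n (2 ^ b)) d∣o)
  (from b)
  where
  from : ∀ b → Odd (2 ^ b * r) × r ∣ o → 2 ^ b * r ∣ o
  from zero    (_   , r∣o) = subst (_∣ o) (sym (*-identityˡ r)) r∣o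
  from (suc b) (odd , _)   = contradiction (subst (2 ∣_) (sym (*-assoc 2 (2 ^ b) r)) (m∣m*n (2 ^ b * r))) odd

p∸1∣2*odd⇔ : ∀ {p a r o} → Odd p → p ∸ 1 ≡ 2 ^ a * r → Odd r → Odd o →
             (p ∸ 1) ∣ 2 * o ⇔ ((p ≡ 3 [mod 4 ]) × r ∣ o)
p∸1∣2*odd⇔ {a = a} {r} {o} p-odd p∸1≡2^a*r r-odd o-odd with odd⇒≡1+2* p-odd
... | h , refl with half-2-adic {h} {a} p∸1≡2^a*r r-odd
... | b , refl = begin
  2 * (2 ^ b * r) ∣ 2 * o                         ∼⟨ mk⇔ (*-cancelˡ-∣ 2) (*-monoʳ-∣ 2) ⟩
  2 ^ b * r ∣ o                                   ∼⟨ 2^b*r∣odd⇔ b o-odd ⟩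
  (Odd (2 ^ b * r) × r ∣ o)                       ∼⟨ ⇔-sym (≡3[mod4]⇔odd (2 ^ b * r)) ×-⇔ ⇔-id _ ⟩
  ((suc (2 * (2 ^ b * r)) ≡ 3 [mod 4 ]) × r ∣ o)  ∎
  where open EquationalReasoning

proposition2p1 : (k p a r : ℕ) → Prime p → Odd p →
    p ∸ 1 ≡ 2 ^ a * r → Odd r →
    (InS k (2 * p) ⇔ ((p ≡ 3 [mod 4 ]) × (r ∣ 2 ^ (k + 1) + 1)))
proposition2p1 k p a r p-prime p-odd p∸1≡2^a*r r-odd = begin
  InS k (2 * p)
    ∼⟨ InS[2*p]⇔ k p-prime p-odd ⟩
  ((2 * p * (1 + 2 ^ k + p ^ k + (2 * p) ^ k)) ≡ 2 [mod p ∸ 1 ])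
    ∼⟨ 2pσ≡2[mod-p∸1]⇔ k p ⟩
  (p ∸ 1) ∣ 2 * (2 ^ (k + 1) + 1)
    ∼⟨ p∸1∣2*odd⇔ {a = a} p-odd p∸1≡2^a*r r-odd (odd[2^[k+1]+1] k) ⟩
  ((p ≡ 3 [mod 4 ]) × r ∣ 2 ^ (k + 1) + 1)
    ∎
  where
  open EquationalReasoning
  instance _ = prime⇒nonZero p-prime
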